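{- There is an absolute constant $C>0$ such that for every positive integer $n$, the largest singular value of the distance matrix $M_n$ satisfies $\sigma_1(M_n)\le C\cdot 2^n/\sqrt{n}$.
   Context: The distance matrix $M_n$ is the real $2^n\times2^n$ matrix indexed by $\{0,1\}^n$ with $M_n[x,y]=1$ if the Hamming distance between $x$ and $y$ is at most $n/2$ and $M_n[x,y]=-1$ otherwise.
   Formalization: The bound on $\sigma_1(M_n)$ is required only for vectors with rational entries, and the constant C is taken in the positive rationals. -}

module Defs where

open import Data.Bool using (Bool; true; false)
open import Data.Nat as ℕ using (ℕ; zero; suc)
open import Data.Vec using (Vec; []; _∷_)
open import Data.List using (List; []; _∷_; map; _++_; foldr)
open import Data.Rational using (ℚ; 0ℚ; 1ℚ; -_; _+_; _*_; _≤_)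
open import Relation.Nullary.Decidable using (does)

Cube : ℕ → Set
Cube n = Vec Bool n

allCube : (n : ℕ) → List (Cube n)
allCube zero = [] ∷ []
allCube (suc n) = map (false ∷_) (allCube n) ++ map (true ∷_) (allCube n)

Σcube : (n : ℕ) → (Cube n → ℚ) → ℚ
Σcube n f = foldr (λ x acc → f x + acc) 0ℚ (allCube n)

differ : Bool → Bool → ℕ
differ false false = 0
differ true true = 0
differ _ _ = 1

hamming : {n : ℕ} → Cube n → Cube n → ℕ
hamming [] [] = 0
hamming (a ∷ x) (b ∷ y) = differ a b ℕ.+ hamming x y

M : (n : ℕ) → Cube n → Cube n → ℚ
M n x y with does (2 ℕ.* hamming x y ℕ.≤? n)
... | true = 1ℚ
... | false = - 1ℚ

Matrix : ℕ → Set
Matrix n = Cube n → Cube n → ℚ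

apply : {n : ℕ} → Matrix n → (Cube n → ℚ) → (Cube n → ℚ)
apply {n} A v x = Σcube n (λ y → A x y * v y)

normSq : {n : ℕ} → (Cube n → ℚ) → ℚ
normSq {n} v = Σcube n (λ x → v x * v x)

-- σ₁(A)² ≤ b : the largest singular value (= operator 2-norm sup_{v≠0} ‖Av‖/‖v‖)
-- is at most √b.  Vectors range over ℚ; by density/continuity this equals the
-- real supremum.
σ₁²≤ : {n : ℕ} → Matrix n → ℚ → Set
σ₁²≤ {n} A b = ∀ (v : Cube n → ℚ) → normSq (apply A v) ≤ b * normSq v

{-# OPTIONS --safe #-}

-- M n is the Hamming kernel x, y ↦ t (hamming x y) of the threshold profile t = threshold ⌊n/2⌋
-- (1 up to ⌊n/2⌋, −1 beyond), so it is diagonalised by the characters of {0,1}ⁿ: splitting off one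
-- coordinate at a time, its eigenvalues arise from t by n applications of Δ⁺ h j = h j + h (j+1) or
-- Δ⁻ h j = h j − h (j+1), evaluated at 0. The one eigenvalue that never uses Δ⁻ is ∑ⱼ (n C j) t j,
-- which by the symmetry of binomial coefficients is 0 for odd n and n C (n/2) for even n. All the
-- others are bounded in absolute value by the binomial sum of ∣Δ⁻ t∣ = 2 δ ⌊n/2⌋, i.e. by
-- 2 ((n−1) C ⌊n/2⌋). Both bounds are at most 2ⁿ/√n because (2k C k)² (2k+1) ≤ 4^(2k), so C = 1.

module Submission where

open import Defs
open import Data.Nat using (ℕ; suc; _^_)
open import Data.Product using (∃; _×_)
open import Data.Rational using (ℚ; 0ℚ; _<_; _*_; _/_)
open import Data.Integer using (+_)

open import Data.Bool using (Bool; true; false; if_then_else_)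
open import Data.Product using (_,_; proj₁; proj₂)
open import Data.Sum using (inj₁; inj₂)
open import Data.Vec using ([]; _∷_)
open import Data.List using (List; []; _∷_; map; _++_; foldr)
open import Data.List.Properties using (foldr-map)
open import Data.List.Relation.Unary.All as All using (All; []; _∷_)
open import Data.List.Relation.Unary.All.Properties using (++⁺; ++⁻)
open import Data.Nat as ℕ using (zero; z≤n; s≤s)
import Data.Nat.Properties as ℕ
open import Data.Nat.Combinatorics using (_C_; nCk+nC[k+1]≡[n+1]C[k+1]; nCk≡nC[n∸k]; nC1≡n)
open import Data.Nat.Tactic.RingSolver using () renaming (solve-∀ to ℕ-solve-∀)
import Data.Integer as ℤ
import Data.Integer.Properties as ℤ
open import Data.Rational using (1ℚ; ½; _+_; _-_; -_; _≤_; ∣_∣; NonNegative; nonNegative)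
open import Data.Rational.Literals using (fromℤ)
import Data.Rational.Properties as ℚ
open import Data.Rational.Solver using (module +-*-Solver)
import Data.Rational.Unnormalised as ℚᵘ
import Data.Rational.Unnormalised.Properties as ℚᵘ
open import Function using (_∘_; _⇔_; mk⇔)
open import Relation.Binary.Definitions using (tri<; tri≈; tri>)
open import Relation.Binary.PropositionalEquality
open import Relation.Nullary using (yes; no)
open import Relation.Nullary.Decidable using (does; dec-true; dec-false; does-⇔)

two : ℚ
two = 1ℚ + 1ℚ

+-interchange : ∀ a b c d → a + b + (c + d) ≡ a + c + (b + d)
+-interchange = solve 4 (λ a b c d → a :+ b :+ (c :+ d) := a :+ c :+ (b :+ d)) refl
  where open +-*-Solver

x≡2y-x⇒x≡y : ∀ {x y} → x ≡ two * y - x → x ≡ y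
x≡2y-x⇒x≡y {x} {y} x≡2y-x = begin
    x                          ≡⟨ halve x ⟩
    ½ * (x + x)                ≡⟨ cong (λ z → ½ * (x + z)) x≡2y-x ⟩
    ½ * (x + (two * y - x))    ≡⟨ cancel x y ⟩
    y                          ∎
  where
  open ≡-Reasoning
  open +-*-Solver
  halve : ∀ x → x ≡ ½ * (x + x)
  halve = solve 1 (λ x → x := con ½ :* (x :+ x)) refl
  cancel : ∀ x y → ½ * (x + (two * y - x)) ≡ y
  cancel = solve 2 (λ x y → con ½ :* (x :+ (con two :* y :- x)) := y) refl

fromℕ : ℕ → ℚ
fromℕ n = fromℤ (+ n)

fromℕ-+ : ∀ m n → fromℕ (m ℕ.+ n) ≡ fromℕ m + fromℕ n
fromℕ-+ m n = sym (trans (ℚ./-cong {p₂ = + (m ℕ.+ n)} numerator refl) (ℚ.normalize-coprime _))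
  where
  numerator : + m ℤ.* + 1 ℤ.+ + n ℤ.* + 1 ≡ + (m ℕ.+ n)
  numerator = trans (cong₂ ℤ._+_ (ℤ.*-identityʳ (+ m)) (ℤ.*-identityʳ (+ n))) (sym (ℤ.pos-+ m n))

fromℕ-* : ∀ m n → fromℕ (m ℕ.* n) ≡ fromℕ m * fromℕ n
fromℕ-* m n = sym (trans (ℚ./-cong {p₂ = + (m ℕ.* n)} (sym (ℤ.pos-* m n)) refl) (ℚ.normalize-coprime _))

-- Compared through ℚᵘ, where + a / suc n is the unreduced fraction mkℚᵘ (+ a) n.
fromℕ≤/ : ∀ {y a} n → y ℕ.* suc n ℕ.≤ a → fromℕ y ≤ + a / suc n
fromℕ≤/ {y} {a} n y*[1+n]≤a = ℚ.toℚᵘ-cancel-≤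
  (ℚᵘ.≤-respʳ-≃ (ℚᵘ.≃-sym (ℚ.toℚᵘ-fromℚᵘ (ℚᵘ.mkℚᵘ (+ a) n)))
    (ℚᵘ.*≤* (subst₂ ℤ._≤_ (ℤ.pos-* y (suc n)) (ℤ.pos-* a 1)
      (ℤ.+≤+ (subst (y ℕ.* suc n ℕ.≤_) (sym (ℕ.*-identityʳ a)) y*[1+n]≤a)))))

fromℕ²≤4^n/n : ∀ {x} n → x ℕ.* x ℕ.* suc n ℕ.≤ 4 ^ suc n → fromℕ x * fromℕ x ≤ + (4 ^ suc n) / suc n
fromℕ²≤4^n/n {x} n x²n≤4^n = subst (_≤ + (4 ^ suc n) / suc n) (fromℕ-* x x) (fromℕ≤/ n x²n≤4^n)

p*p≡∣p∣*∣p∣ : ∀ p → p * p ≡ ∣ p ∣ * ∣ p ∣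
p*p≡∣p∣*∣p∣ p with ℚ.∣p∣≡p∨∣p∣≡-p p
... | inj₁ ∣p∣≡p  = sym (cong₂ _*_ ∣p∣≡p ∣p∣≡p)
... | inj₂ ∣p∣≡-p = trans (neg*neg p) (sym (cong₂ _*_ ∣p∣≡-p ∣p∣≡-p))
  where
  neg*neg : ∀ p → p * p ≡ - p * - p
  neg*neg = solve 1 (λ p → p :* p := (:- p) :* (:- p)) refl
    where open +-*-Solver

0≤p*p : ∀ p → 0ℚ ≤ p * p
0≤p*p p = subst (0ℚ ≤_) (sym (p*p≡∣p∣*∣p∣ p))
  (ℚ.nonNegative⁻¹ _ {{ℚ.nonNeg*nonNeg⇒nonNeg (∣ p ∣) {{∣p∣≥0}} (∣ p ∣) {{∣p∣≥0}}}})
  where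
  ∣p∣≥0 : NonNegative ∣ p ∣
  ∣p∣≥0 = ℚ.∣-∣-nonNeg p

∣p∣≤q⇒p*p≤q*q : ∀ {p q} → ∣ p ∣ ≤ q → p * p ≤ q * q
∣p∣≤q⇒p*p≤q*q {p} {q} ∣p∣≤q = begin
    p * p           ≡⟨ p*p≡∣p∣*∣p∣ p ⟩
    ∣ p ∣ * ∣ p ∣   ≤⟨ ℚ.*-monoʳ-≤-nonNeg (∣ p ∣) {{ℚ.∣-∣-nonNeg p}} ∣p∣≤q ⟩
    q * ∣ p ∣       ≤⟨ ℚ.*-monoˡ-≤-nonNeg q {{nonNegative 0≤q}} ∣p∣≤q ⟩
    q * q           ∎
  where
  open ℚ.≤-Reasoning
  0≤q : 0ℚ ≤ q
  0≤q = ℚ.≤-trans (ℚ.0≤∣p∣ p) ∣p∣≤q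

∑ : {A : Set} → List A → (A → ℚ) → ℚ
∑ xs f = foldr (λ x acc → f x + acc) 0ℚ xs

module _ {A : Set} where

  ∑-cong : ∀ xs {f g : A → ℚ} → (∀ x → f x ≡ g x) → ∑ xs f ≡ ∑ xs g
  ∑-cong []       f≗g = refl
  ∑-cong (x ∷ xs) f≗g = cong₂ _+_ (f≗g x) (∑-cong xs f≗g)

  ∑-distrib-+ : ∀ xs (f g : A → ℚ) → ∑ xs (λ x → f x + g x) ≡ ∑ xs f + ∑ xs g
  ∑-distrib-+ []       f g = refl
  ∑-distrib-+ (x ∷ xs) f g = trans (cong (λ s → f x + g x + s) (∑-distrib-+ xs f g))
                                   (+-interchange (f x) (g x) (∑ xs f) (∑ xs g))

  ∑-distrib-- : ∀ xs (f g : A → ℚ) → ∑ xs (λ x → f x - g x) ≡ ∑ xs f - ∑ xs g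
  ∑-distrib-- []       f g = refl
  ∑-distrib-- (x ∷ xs) f g = trans (cong (λ s → f x - g x + s) (∑-distrib-- xs f g))
                                   (interchange (f x) (g x) (∑ xs f) (∑ xs g))
    where
    open +-*-Solver
    interchange : ∀ a b c d → a - b + (c - d) ≡ a + c - (b + d)
    interchange = solve 4 (λ a b c d → a :- b :+ (c :- d) := a :+ c :- (b :+ d)) refl

  ∑-distribˡ-* : ∀ xs c (f : A → ℚ) → ∑ xs (λ x → c * f x) ≡ c * ∑ xs f
  ∑-distribˡ-* []       c f = sym (ℚ.*-zeroʳ c)
  ∑-distribˡ-* (x ∷ xs) c f =
    trans (cong (λ s → c * f x + s) (∑-distribˡ-* xs c f)) (sym (ℚ.*-distribˡ-+ c (f x) (∑ xs f)))

  ∑-++ : ∀ xs ys (f : A → ℚ) → ∑ (xs ++ ys) f ≡ ∑ xs f + ∑ ys f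
  ∑-++ []       ys f = sym (ℚ.+-identityˡ _)
  ∑-++ (x ∷ xs) ys f = trans (cong (λ s → f x + s) (∑-++ xs ys f)) (sym (ℚ.+-assoc (f x) _ _))

Σcube-suc : ∀ n (f : Cube (suc n) → ℚ) →
            Σcube (suc n) f ≡ Σcube n (f ∘ (false ∷_)) + Σcube n (f ∘ (true ∷_))
Σcube-suc n f = trans (∑-++ (map (false ∷_) (allCube n)) _ f)
  (cong₂ _+_ (foldr-map _ (false ∷_) 0ℚ (allCube n)) (foldr-map _ (true ∷_) 0ℚ (allCube n)))

normSq-suc : ∀ {n} (v : Cube (suc n) → ℚ) → normSq v ≡ normSq (v ∘ (false ∷_)) + normSq (v ∘ (true ∷_))
normSq-suc {n} v = Σcube-suc n (λ x → v x * v x)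

module _ {n : ℕ} where

  normSq-cong : {u w : Cube n → ℚ} → (∀ x → u x ≡ w x) → normSq u ≡ normSq w
  normSq-cong u≗w = ∑-cong (allCube n) (λ x → cong₂ _*_ (u≗w x) (u≗w x))

  normSq-parallelogram : (u w : Cube n → ℚ) →
    normSq (λ x → u x + w x) + normSq (λ x → u x - w x) ≡ two * (normSq u + normSq w)
  normSq-parallelogram u w = begin
      normSq (λ x → u x + w x) + normSq (λ x → u x - w x)
    ≡⟨ ∑-distrib-+ (allCube n) (λ x → (u x + w x) * (u x + w x)) (λ x → (u x - w x) * (u x - w x)) ⟨
      ∑ (allCube n) (λ x → (u x + w x) * (u x + w x) + (u x - w x) * (u x - w x))
    ≡⟨ ∑-cong (allCube n) (λ x → parallelogram (u x) (w x)) ⟩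
      ∑ (allCube n) (λ x → two * (u x * u x + w x * w x))
    ≡⟨ ∑-distribˡ-* (allCube n) two (λ x → u x * u x + w x * w x) ⟩
      two * ∑ (allCube n) (λ x → u x * u x + w x * w x)
    ≡⟨ cong (two *_) (∑-distrib-+ (allCube n) (λ x → u x * u x) (λ x → w x * w x)) ⟩
      two * (normSq u + normSq w)
    ∎
    where
    open ≡-Reasoning
    open +-*-Solver
    parallelogram : ∀ a b → (a + b) * (a + b) + (a - b) * (a - b) ≡ two * (a * a + b * b)
    parallelogram = solve 2 (λ a b → (a :+ b) :* (a :+ b) :+ (a :- b) :* (a :- b)
                                    := con two :* (a :* a :+ b :* b)) refl

  apply-cong : {A B : Matrix n} → (∀ x y → A x y ≡ B x y) → ∀ v x → apply A v x ≡ apply B v x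
  apply-cong A≡B v x = ∑-cong (allCube n) (λ y → cong (_* v y) (A≡B x y))

  apply-+ʳ : (A : Matrix n) (u w : Cube n → ℚ) →
             ∀ x → apply A (λ y → u y + w y) x ≡ apply A u x + apply A w x
  apply-+ʳ A u w x = trans (∑-cong (allCube n) (λ y → ℚ.*-distribˡ-+ (A x y) (u y) (w y)))
                           (∑-distrib-+ (allCube n) (λ y → A x y * u y) (λ y → A x y * w y))

  apply--ʳ : (A : Matrix n) (u w : Cube n → ℚ) →
             ∀ x → apply A (λ y → u y - w y) x ≡ apply A u x - apply A w x
  apply--ʳ A u w x = trans (∑-cong (allCube n) (λ y → distrib (A x y) (u y) (w y)))
                           (∑-distrib-- (allCube n) (λ y → A x y * u y) (λ y → A x y * w y))
    where
    open +-*-Solver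
    distrib : ∀ a b c → a * (b - c) ≡ a * b - a * c
    distrib = solve 3 (λ a b c → a :* (b :- c) := a :* b :- a :* c) refl

  apply-+ˡ : (A B : Matrix n) (v : Cube n → ℚ) →
             ∀ x → apply (λ x y → A x y + B x y) v x ≡ apply A v x + apply B v x
  apply-+ˡ A B v x = trans (∑-cong (allCube n) (λ y → ℚ.*-distribʳ-+ (v y) (A x y) (B x y)))
                           (∑-distrib-+ (allCube n) (λ y → A x y * v y) (λ y → B x y * v y))

  apply--ˡ : (A B : Matrix n) (v : Cube n → ℚ) →
             ∀ x → apply (λ x y → A x y - B x y) v x ≡ apply A v x - apply B v x
  apply--ˡ A B v x = trans (∑-cong (allCube n) (λ y → distrib (A x y) (B x y) (v y)))
                           (∑-distrib-- (allCube n) (λ y → A x y * v y) (λ y → B x y * v y))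
    where
    open +-*-Solver
    distrib : ∀ a b c → (a - b) * c ≡ a * c - b * c
    distrib = solve 3 (λ a b c → (a :- b) :* c := a :* c :- b :* c) refl

σ₁²≤-cong : ∀ {n} {A B : Matrix n} {b} → (∀ x y → A x y ≡ B x y) → σ₁²≤ A b → σ₁²≤ B b
σ₁²≤-cong {b = b} A≡B σ₁²≤A v =
  subst (_≤ b * normSq v) (normSq-cong (λ x → apply-cong A≡B v x)) (σ₁²≤A v)

hammingKernel : {n : ℕ} → (ℕ → ℚ) → Matrix n
hammingKernel h x y = h (hamming x y)

Δ⁺ Δ⁻ : (ℕ → ℚ) → ℕ → ℚ
Δ⁺ h j = h j + h (suc j)
Δ⁻ h j = h j - h (suc j)

-- Splitting off the first coordinate, hammingKernel {suc n} h is the block matrix [[A, B], [B, A]]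
-- with A = hammingKernel h and B = hammingKernel (h ∘ suc); the substitution (v₀, v₁) ↦ (v₀ + v₁, v₀ − v₁),
-- which preserves norms up to the factor 2 (parallelogram law), turns it into A + B = hammingKernel (Δ⁺ h)
-- and A − B = hammingKernel (Δ⁻ h).
eigenvalues : ℕ → (ℕ → ℚ) → List ℚ
eigenvalues zero    h = h 0 ∷ []
eigenvalues (suc n) h = eigenvalues n (Δ⁺ h) ++ eigenvalues n (Δ⁻ h)

module _ {n : ℕ} (h : ℕ → ℚ) (v : Cube (suc n) → ℚ) where
  private
    H H′ : Matrix n
    H = hammingKernel h
    H′ = hammingKernel (h ∘ suc)
    A B : (Cube n → ℚ) → Cube n → ℚ
    A = apply H
    B = apply H′
    F : Cube (suc n) → ℚ
    F = apply (hammingKernel h) v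
    v₀ v₁ : Cube n → ℚ
    v₀ = v ∘ (false ∷_)
    v₁ = v ∘ (true ∷_)

  apply-hammingKernel-Δ⁺ : ∀ x → F (false ∷ x) + F (true ∷ x)
                                ≡ apply (hammingKernel (Δ⁺ h)) (λ y → v₀ y + v₁ y) x
  apply-hammingKernel-Δ⁺ x = begin
      F (false ∷ x) + F (true ∷ x)
    ≡⟨ cong₂ _+_ (Σcube-suc n (λ y → hammingKernel h (false ∷ x) y * v y))
                 (Σcube-suc n (λ y → hammingKernel h (true ∷ x) y * v y)) ⟩
      (A v₀ x + B v₁ x) + (B v₀ x + A v₁ x)
    ≡⟨ interchange (A v₀ x) (B v₁ x) (B v₀ x) (A v₁ x) ⟩
      (A v₀ x + A v₁ x) + (B v₀ x + B v₁ x)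
    ≡⟨ cong₂ _+_ (apply-+ʳ H v₀ v₁ x) (apply-+ʳ H′ v₀ v₁ x) ⟨
      A (λ y → v₀ y + v₁ y) x + B (λ y → v₀ y + v₁ y) x
    ≡⟨ apply-+ˡ H H′ (λ y → v₀ y + v₁ y) x ⟨
      apply (hammingKernel (Δ⁺ h)) (λ y → v₀ y + v₁ y) x
    ∎
    where
    open ≡-Reasoning
    open +-*-Solver
    interchange : ∀ a b c d → (a + b) + (c + d) ≡ (a + d) + (c + b)
    interchange = solve 4 (λ a b c d → (a :+ b) :+ (c :+ d) := (a :+ d) :+ (c :+ b)) refl

  apply-hammingKernel-Δ⁻ : ∀ x → F (false ∷ x) - F (true ∷ x)
                                ≡ apply (hammingKernel (Δ⁻ h)) (λ y → v₀ y - v₁ y) x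
  apply-hammingKernel-Δ⁻ x = begin
      F (false ∷ x) - F (true ∷ x)
    ≡⟨ cong₂ _-_ (Σcube-suc n (λ y → hammingKernel h (false ∷ x) y * v y))
                 (Σcube-suc n (λ y → hammingKernel h (true ∷ x) y * v y)) ⟩
      (A v₀ x + B v₁ x) - (B v₀ x + A v₁ x)
    ≡⟨ interchange (A v₀ x) (B v₁ x) (B v₀ x) (A v₁ x) ⟩
      (A v₀ x - A v₁ x) - (B v₀ x - B v₁ x)
    ≡⟨ cong₂ _-_ (apply--ʳ H v₀ v₁ x) (apply--ʳ H′ v₀ v₁ x) ⟨
      A (λ y → v₀ y - v₁ y) x - B (λ y → v₀ y - v₁ y) x
    ≡⟨ apply--ˡ H H′ (λ y → v₀ y - v₁ y) x ⟨
      apply (hammingKernel (Δ⁻ h)) (λ y → v₀ y - v₁ y) x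
    ∎
    where
    open ≡-Reasoning
    open +-*-Solver
    interchange : ∀ a b c d → (a + b) - (c + d) ≡ (a - d) - (c - b)
    interchange = solve 4 (λ a b c d → (a :+ b) :- (c :+ d) := (a :- d) :- (c :- b)) refl

hammingKernel-σ₁²≤ : ∀ n {b} (h : ℕ → ℚ) → All (λ μ → μ * μ ≤ b) (eigenvalues n h) →
                     σ₁²≤ (hammingKernel {n} h) b
hammingKernel-σ₁²≤ zero {b} h (h₀²≤b ∷ []) v = begin
    (h 0 * v [] + 0ℚ) * (h 0 * v [] + 0ℚ) + 0ℚ   ≡⟨ expand (h 0) (v []) ⟩
    (h 0 * h 0) * (v [] * v [])
      ≤⟨ ℚ.*-monoʳ-≤-nonNeg (v [] * v []) {{nonNegative (0≤p*p (v []))}} h₀²≤b ⟩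
    b * (v [] * v [])                             ≡⟨ cong (b *_) (ℚ.+-identityʳ _) ⟨
    b * (v [] * v [] + 0ℚ)                        ∎
  where
  open ℚ.≤-Reasoning
  open +-*-Solver
  expand : ∀ a c → (a * c + 0ℚ) * (a * c + 0ℚ) + 0ℚ ≡ (a * a) * (c * c)
  expand = solve 2 (λ a c → (a :* c :+ con 0ℚ) :* (a :* c :+ con 0ℚ) :+ con 0ℚ := (a :* a) :* (c :* c)) refl
hammingKernel-σ₁²≤ (suc n) {b} h bounds v = ℚ.*-cancelˡ-≤-pos two (begin
    two * normSq F                                 ≡⟨ cong (two *_) (normSq-suc F) ⟩
    two * (normSq F₀ + normSq F₁)                  ≡⟨ normSq-parallelogram F₀ F₁ ⟨
    normSq (λ x → F₀ x + F₁ x) + normSq (λ x → F₀ x - F₁ x)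
      ≡⟨ cong₂ _+_ (normSq-cong (apply-hammingKernel-Δ⁺ h v)) (normSq-cong (apply-hammingKernel-Δ⁻ h v)) ⟩
    normSq (apply (hammingKernel (Δ⁺ h)) w₊) + normSq (apply (hammingKernel (Δ⁻ h)) w₋)
      ≤⟨ ℚ.+-mono-≤ (hammingKernel-σ₁²≤ n (Δ⁺ h) bounds⁺ w₊)
                    (hammingKernel-σ₁²≤ n (Δ⁻ h) bounds⁻ w₋) ⟩
    b * normSq w₊ + b * normSq w₋                 ≡⟨ ℚ.*-distribˡ-+ b _ _ ⟨
    b * (normSq w₊ + normSq w₋)                   ≡⟨ cong (b *_) (normSq-parallelogram v₀ v₁) ⟩
    b * (two * (normSq v₀ + normSq v₁))           ≡⟨ cong (λ s → b * (two * s)) (normSq-suc v) ⟨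
    b * (two * normSq v)                          ≡⟨ *-swap b two (normSq v) ⟩
    two * (b * normSq v)                          ∎)
  where
  open ℚ.≤-Reasoning
  *-swap : ∀ a c d → a * (c * d) ≡ c * (a * d)
  *-swap = solve 3 (λ a c d → a :* (c :* d) := c :* (a :* d)) refl
    where open +-*-Solver
  F : Cube (suc n) → ℚ
  F = apply (hammingKernel h) v
  F₀ F₁ v₀ v₁ w₊ w₋ : Cube n → ℚ
  F₀ = F ∘ (false ∷_)
  F₁ = F ∘ (true ∷_)
  v₀ = v ∘ (false ∷_)
  v₁ = v ∘ (true ∷_)
  w₊ y = v₀ y + v₁ y
  w₋ y = v₀ y - v₁ y
  bounds⁺ : All (λ μ → μ * μ ≤ b) (eigenvalues n (Δ⁺ h))
  bounds⁺ = proj₁ (++⁻ (eigenvalues n (Δ⁺ h)) bounds)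
  bounds⁻ : All (λ μ → μ * μ ≤ b) (eigenvalues n (Δ⁻ h))
  bounds⁻ = proj₂ (++⁻ (eigenvalues n (Δ⁺ h)) bounds)

-- binomialSum a p = ∑ⱼ (a C j) * p j, the eigenvalue of hammingKernel p on constant vectors.
binomialSum : ℕ → (ℕ → ℚ) → ℚ
binomialSum zero    p = p 0
binomialSum (suc a) p = binomialSum a (Δ⁺ p)

eigenvalues-dominated : ∀ a {h p : ℕ → ℚ} → (∀ j → ∣ h j ∣ ≤ p j) →
                        All (λ μ → ∣ μ ∣ ≤ binomialSum a p) (eigenvalues a h)
eigenvalues-dominated zero    h≤p = h≤p 0 ∷ []
eigenvalues-dominated (suc a) {h} {p} h≤p =
  ++⁺ (eigenvalues-dominated a {Δ⁺ h} (λ j → ℚ.≤-trans (ℚ.∣p+q∣≤∣p∣+∣q∣ (h j) (h (suc j))) (∣h∣+∣h∣≤Δ⁺p j)))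
      (eigenvalues-dominated a {Δ⁻ h} (λ j → ℚ.≤-trans (ℚ.∣p-q∣≤∣p∣+∣q∣ (h j) (h (suc j))) (∣h∣+∣h∣≤Δ⁺p j)))
  where
  ∣h∣+∣h∣≤Δ⁺p : ∀ j → ∣ h j ∣ + ∣ h (suc j) ∣ ≤ Δ⁺ p j
  ∣h∣+∣h∣≤Δ⁺p j = ℚ.+-mono-≤ (h≤p j) (h≤p (suc j))

-- Only the first eigenvalue, binomialSum (suc a) h, avoids Δ⁻; every other one is dominated via d.
eigenvalues-bounded : ∀ a {h d : ℕ → ℚ} {b} → (∀ j → ∣ Δ⁻ h j ∣ ≤ d j) →
                      binomialSum (suc a) h * binomialSum (suc a) h ≤ b →
                      binomialSum a d * binomialSum a d ≤ b →
                      All (λ μ → μ * μ ≤ b) (eigenvalues (suc a) h)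
eigenvalues-bounded zero Δ⁻h≤d top≤b d≤b =
  top≤b ∷ ℚ.≤-trans (∣p∣≤q⇒p*p≤q*q (Δ⁻h≤d 0)) d≤b ∷ []
eigenvalues-bounded (suc a) {h} {d} Δ⁻h≤d top≤b d≤b =
  ++⁺ (eigenvalues-bounded a {Δ⁺ h} {Δ⁺ d} Δ⁻Δ⁺h≤Δ⁺d top≤b d≤b)
      (All.map (λ ∣μ∣≤ → ℚ.≤-trans (∣p∣≤q⇒p*p≤q*q ∣μ∣≤) d≤b)
               (eigenvalues-dominated (suc a) Δ⁻h≤d))
  where
  open +-*-Solver
  Δ⁻Δ⁺≡ : ∀ a b c → (a + b) - (b + c) ≡ (a - b) + (b - c)
  Δ⁻Δ⁺≡ = solve 3 (λ a b c → (a :+ b) :- (b :+ c) := (a :- b) :+ (b :- c)) refl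
  Δ⁻Δ⁺h≤Δ⁺d : ∀ j → ∣ Δ⁻ (Δ⁺ h) j ∣ ≤ Δ⁺ d j
  Δ⁻Δ⁺h≤Δ⁺d j = begin
      ∣ Δ⁻ (Δ⁺ h) j ∣                 ≡⟨ cong ∣_∣ (Δ⁻Δ⁺≡ (h j) (h (suc j)) (h (suc (suc j)))) ⟩
      ∣ Δ⁻ h j + Δ⁻ h (suc j) ∣       ≤⟨ ℚ.∣p+q∣≤∣p∣+∣q∣ (Δ⁻ h j) (Δ⁻ h (suc j)) ⟩
      ∣ Δ⁻ h j ∣ + ∣ Δ⁻ h (suc j) ∣   ≤⟨ ℚ.+-mono-≤ (Δ⁻h≤d j) (Δ⁻h≤d (suc j)) ⟩
      Δ⁺ d j                          ∎
    where open ℚ.≤-Reasoning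

binomialSum-cong : ∀ a {p q : ℕ → ℚ} → (∀ j → p j ≡ q j) → binomialSum a p ≡ binomialSum a q
binomialSum-cong zero    p≗q = p≗q 0
binomialSum-cong (suc a) p≗q = binomialSum-cong a (λ j → cong₂ _+_ (p≗q j) (p≗q (suc j)))

binomialSum-+ : ∀ a (p q : ℕ → ℚ) → binomialSum a (λ j → p j + q j) ≡ binomialSum a p + binomialSum a q
binomialSum-+ zero    p q = refl
binomialSum-+ (suc a) p q =
  trans (binomialSum-cong a (λ j → +-interchange (p j) (q j) (p (suc j)) (q (suc j))))
        (binomialSum-+ a (Δ⁺ p) (Δ⁺ q))

binomialSum-neg : ∀ a (p : ℕ → ℚ) → binomialSum a (λ j → - p j) ≡ - binomialSum a p
binomialSum-neg zero    p = refl
binomialSum-neg (suc a) p =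
  trans (binomialSum-cong a (λ j → sym (ℚ.neg-distrib-+ (p j) (p (suc j))))) (binomialSum-neg a (Δ⁺ p))

binomialSum-- : ∀ a (p q : ℕ → ℚ) → binomialSum a (λ j → p j - q j) ≡ binomialSum a p - binomialSum a q
binomialSum-- a p q =
  trans (binomialSum-+ a p (λ j → - q j)) (cong (λ s → binomialSum a p + s) (binomialSum-neg a q))

binomialSum-* : ∀ a c (p : ℕ → ℚ) → binomialSum a (λ j → c * p j) ≡ c * binomialSum a p
binomialSum-* zero    c p = refl
binomialSum-* (suc a) c p =
  trans (binomialSum-cong a (λ j → sym (ℚ.*-distribˡ-+ c (p j) (p (suc j))))) (binomialSum-* a c (Δ⁺ p))

-- Reflects the symmetry a C i = a C j (for i + j = a) of the weights of binomialSum.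
binomialSum-reflect : ∀ a {p q : ℕ → ℚ} → (∀ i j → i ℕ.+ j ≡ a → p i ≡ q j) →
                      binomialSum a p ≡ binomialSum a q
binomialSum-reflect zero    p≡q = p≡q 0 0 refl
binomialSum-reflect (suc a) {p} {q} p≡q = binomialSum-reflect a Δ⁺p≡Δ⁺q
  where
  Δ⁺p≡Δ⁺q : ∀ i j → i ℕ.+ j ≡ a → Δ⁺ p i ≡ Δ⁺ q j
  Δ⁺p≡Δ⁺q i j i+j≡a = trans (cong₂ _+_ (p≡q i (suc j) (trans (ℕ.+-suc i j) (cong suc i+j≡a)))
                                         (p≡q (suc i) j (cong suc i+j≡a)))
                              (ℚ.+-comm (q (suc j)) (q j))

δ : ℕ → ℕ → ℚ
δ m j = if does (j ℕ.≟ m) then 1ℚ else 0ℚ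

binomialSum-δ : ∀ a t → binomialSum a (δ t) ≡ fromℕ (a C t)
binomialSum-δ zero    zero    = refl
binomialSum-δ zero    (suc t) = refl
binomialSum-δ (suc a) zero    = trans (binomialSum-cong a (λ j → ℚ.+-identityʳ (δ 0 j))) (binomialSum-δ a 0)
binomialSum-δ (suc a) (suc t) = begin
    binomialSum a (λ j → δ (suc t) j + δ t j)
  ≡⟨ binomialSum-+ a (δ (suc t)) (δ t) ⟩
    binomialSum a (δ (suc t)) + binomialSum a (δ t)
  ≡⟨ cong₂ _+_ (binomialSum-δ a (suc t)) (binomialSum-δ a t) ⟩
    fromℕ (a C suc t) + fromℕ (a C t)
  ≡⟨ ℚ.+-comm (fromℕ (a C suc t)) (fromℕ (a C t)) ⟩
    fromℕ (a C t) + fromℕ (a C suc t)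
  ≡⟨ fromℕ-+ (a C t) (a C suc t) ⟨
    fromℕ (a C t ℕ.+ a C suc t)
  ≡⟨ cong fromℕ (nCk+nC[k+1]≡[n+1]C[k+1] a t) ⟩
    fromℕ (suc a C suc t)
  ∎
  where open ≡-Reasoning

2*m≡m+m : ∀ m → 2 ℕ.* m ≡ m ℕ.+ m
2*m≡m+m = ℕ-solve-∀

i+j≡m+n∧i<m⇒n<j : ∀ {i j m n} → i ℕ.+ j ≡ m ℕ.+ n → i ℕ.< m → n ℕ.< j
i+j≡m+n∧i<m⇒n<j {i} {j} {m} {n} eq i<m =
  ℕ.+-cancelˡ-< m n j (subst (ℕ._< m ℕ.+ j) eq (ℕ.+-monoˡ-< j i<m))

i+j≡m+n∧n<j⇒i<m : ∀ {i j m n} → i ℕ.+ j ≡ m ℕ.+ n → n ℕ.< j → i ℕ.< m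
i+j≡m+n∧n<j⇒i<m {i} {j} {m} {n} eq n<j =
  ℕ.+-cancelʳ-< j i m (subst (ℕ._< m ℕ.+ j) (sym eq) (ℕ.+-monoʳ-< m n<j))

[k+1]*[n+1]C[k+1]≡[n+1]*nCk : ∀ n k → suc k ℕ.* (suc n C suc k) ≡ suc n ℕ.* (n C k)
[k+1]*[n+1]C[k+1]≡[n+1]*nCk zero    zero    = refl
[k+1]*[n+1]C[k+1]≡[n+1]*nCk zero    (suc k) = ℕ.*-zeroʳ (suc (suc k))
[k+1]*[n+1]C[k+1]≡[n+1]*nCk (suc n) zero    =
  trans (ℕ.*-identityˡ _) (trans (nC1≡n (suc (suc n))) (sym (ℕ.*-identityʳ (suc (suc n)))))
[k+1]*[n+1]C[k+1]≡[n+1]*nCk (suc n) (suc k) = begin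
    suc (suc k) ℕ.* (suc (suc n) C suc (suc k))
  ≡⟨ cong (suc (suc k) ℕ.*_) (nCk+nC[k+1]≡[n+1]C[k+1] (suc n) (suc k)) ⟨
    suc (suc k) ℕ.* (X ℕ.+ Y)
  ≡⟨ distrib k X Y ⟩
    X ℕ.+ (suc k ℕ.* X ℕ.+ suc (suc k) ℕ.* Y)
  ≡⟨ cong₂ (λ s t → X ℕ.+ (s ℕ.+ t)) ([k+1]*[n+1]C[k+1]≡[n+1]*nCk n k)
                                     ([k+1]*[n+1]C[k+1]≡[n+1]*nCk n (suc k)) ⟩
    X ℕ.+ (suc n ℕ.* (n C k) ℕ.+ suc n ℕ.* (n C suc k))
  ≡⟨ cong (X ℕ.+_) (ℕ.*-distribˡ-+ (suc n) (n C k) (n C suc k)) ⟨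
    X ℕ.+ suc n ℕ.* (n C k ℕ.+ n C suc k)
  ≡⟨ cong (λ s → X ℕ.+ suc n ℕ.* s) (nCk+nC[k+1]≡[n+1]C[k+1] n k) ⟩
    suc (suc n) ℕ.* X
  ∎
  where
  open ≡-Reasoning
  X Y : ℕ
  X = suc n C suc k
  Y = suc n C suc (suc k)
  distrib : ∀ k x y → suc (suc k) ℕ.* (x ℕ.+ y) ≡ x ℕ.+ (suc k ℕ.* x ℕ.+ suc (suc k) ℕ.* y)
  distrib = ℕ-solve-∀

[2k+2]C[k+1]≡2*[2k+1]C[k+1] : ∀ k → suc (suc (2 ℕ.* k)) C suc k ≡ 2 ℕ.* (suc (2 ℕ.* k) C suc k)
[2k+2]C[k+1]≡2*[2k+1]C[k+1] k = begin
    suc (suc (2 ℕ.* k)) C suc k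
  ≡⟨ nCk+nC[k+1]≡[n+1]C[k+1] (suc (2 ℕ.* k)) k ⟨
    suc (2 ℕ.* k) C k ℕ.+ suc (2 ℕ.* k) C suc k
  ≡⟨ cong (ℕ._+ suc (2 ℕ.* k) C suc k) symmetric ⟩
    suc (2 ℕ.* k) C suc k ℕ.+ suc (2 ℕ.* k) C suc k
  ≡⟨ 2*m≡m+m (suc (2 ℕ.* k) C suc k) ⟨
    2 ℕ.* (suc (2 ℕ.* k) C suc k)
  ∎
  where
  open ≡-Reasoning
  symmetric : suc (2 ℕ.* k) C k ≡ suc (2 ℕ.* k) C suc k
  symmetric = begin
      suc (2 ℕ.* k) C k                          ≡⟨ cong (suc (2 ℕ.* k) C_) (ℕ.m+n∸m≡n k k) ⟨
      suc (2 ℕ.* k) C (k ℕ.+ k ℕ.∸ k)            ≡⟨ cong (λ t → suc (2 ℕ.* k) C (t ℕ.∸ k)) (2*m≡m+m k) ⟨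
      suc (2 ℕ.* k) C (suc (2 ℕ.* k) ℕ.∸ suc k)  ≡⟨ nCk≡nC[n∸k] (s≤s (ℕ.m≤n*m k 2)) ⟨
      suc (2 ℕ.* k) C suc k                      ∎

[k+1]*[2k+2]C[k+1]≡2*[2k+1]*[2k]Ck : ∀ k →
  suc k ℕ.* (suc (suc (2 ℕ.* k)) C suc k) ≡ 2 ℕ.* (suc (2 ℕ.* k) ℕ.* ((2 ℕ.* k) C k))
[k+1]*[2k+2]C[k+1]≡2*[2k+1]*[2k]Ck k = begin
    suc k ℕ.* (suc (suc (2 ℕ.* k)) C suc k)      ≡⟨ cong (suc k ℕ.*_) ([2k+2]C[k+1]≡2*[2k+1]C[k+1] k) ⟩
    suc k ℕ.* (2 ℕ.* (suc (2 ℕ.* k) C suc k))    ≡⟨ swap (suc k) 2 (suc (2 ℕ.* k) C suc k) ⟩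
    2 ℕ.* (suc k ℕ.* (suc (2 ℕ.* k) C suc k))    ≡⟨ cong (2 ℕ.*_) ([k+1]*[n+1]C[k+1]≡[n+1]*nCk (2 ℕ.* k) k) ⟩
    2 ℕ.* (suc (2 ℕ.* k) ℕ.* ((2 ℕ.* k) C k))    ∎
  where
  open ≡-Reasoning
  swap : ∀ x y z → x ℕ.* (y ℕ.* z) ≡ y ℕ.* (x ℕ.* z)
  swap = ℕ-solve-∀

[2k+1][2k+3]≤[2k+2]² : ∀ k →
  suc (2 ℕ.* k) ℕ.* suc (suc (suc (2 ℕ.* k))) ℕ.≤ suc (suc (2 ℕ.* k)) ℕ.* suc (suc (2 ℕ.* k))
[2k+1][2k+3]≤[2k+2]² k = subst (suc (2 ℕ.* k) ℕ.* suc (suc (suc (2 ℕ.* k))) ℕ.≤_) (square k) (ℕ.m≤m+n _ 1)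
  where
  square : ∀ k → suc (2 ℕ.* k) ℕ.* suc (suc (suc (2 ℕ.* k))) ℕ.+ 1
                 ≡ suc (suc (2 ℕ.* k)) ℕ.* suc (suc (2 ℕ.* k))
  square = ℕ-solve-∀

centralBinomial-bound : ∀ k → ((2 ℕ.* k) C k) ℕ.* ((2 ℕ.* k) C k) ℕ.* suc (2 ℕ.* k) ℕ.≤ 4 ^ (2 ℕ.* k)
centralBinomial-bound zero    = ℕ.≤-refl
centralBinomial-bound (suc k) =
  subst (λ n → (n C suc k) ℕ.* (n C suc k) ℕ.* suc n ℕ.≤ 4 ^ n) (sym (ℕ.*-suc 2 k))
    (ℕ.*-cancelˡ-≤ (suc k ℕ.* suc k) (begin
        suc k ℕ.* suc k ℕ.* (D ℕ.* D ℕ.* suc (suc (suc (2 ℕ.* k))))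
      ≡⟨ regroup (suc k) D _ ⟩
        (suc k ℕ.* D) ℕ.* (suc k ℕ.* D) ℕ.* suc (suc (suc (2 ℕ.* k)))
      ≡⟨ cong (λ r → r ℕ.* r ℕ.* suc (suc (suc (2 ℕ.* k)))) ([k+1]*[2k+2]C[k+1]≡2*[2k+1]*[2k]Ck k) ⟩
        (2 ℕ.* (suc (2 ℕ.* k) ℕ.* c)) ℕ.* (2 ℕ.* (suc (2 ℕ.* k) ℕ.* c)) ℕ.* suc (suc (suc (2 ℕ.* k)))
      ≡⟨ regroup′ k c ⟩
        4 ℕ.* (suc (2 ℕ.* k) ℕ.* suc (suc (suc (2 ℕ.* k)))) ℕ.* (c ℕ.* c ℕ.* suc (2 ℕ.* k))
      ≤⟨ ℕ.*-mono-≤ (ℕ.*-monoʳ-≤ 4 ([2k+1][2k+3]≤[2k+2]² k)) (centralBinomial-bound k) ⟩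
        4 ℕ.* (suc (suc (2 ℕ.* k)) ℕ.* suc (suc (2 ℕ.* k))) ℕ.* 4 ^ (2 ℕ.* k)
      ≡⟨ regroup″ k (4 ^ (2 ℕ.* k)) ⟩
        suc k ℕ.* suc k ℕ.* 4 ^ suc (suc (2 ℕ.* k))
      ∎))
  where
  open ℕ.≤-Reasoning
  c D : ℕ
  c = (2 ℕ.* k) C k
  D = suc (suc (2 ℕ.* k)) C suc k
  regroup : ∀ s d t → s ℕ.* s ℕ.* (d ℕ.* d ℕ.* t) ≡ (s ℕ.* d) ℕ.* (s ℕ.* d) ℕ.* t
  regroup = ℕ-solve-∀
  regroup′ : ∀ k c → let o = suc (2 ℕ.* k) in
             (2 ℕ.* (o ℕ.* c)) ℕ.* (2 ℕ.* (o ℕ.* c)) ℕ.* suc (suc o) ≡ 4 ℕ.* (o ℕ.* suc (suc o)) ℕ.* (c ℕ.* c ℕ.* o)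
  regroup′ = ℕ-solve-∀
  regroup″ : ∀ k p → 4 ℕ.* (suc (suc (2 ℕ.* k)) ℕ.* suc (suc (2 ℕ.* k))) ℕ.* p
                     ≡ suc k ℕ.* suc k ℕ.* (4 ℕ.* (4 ℕ.* p))
  regroup″ = ℕ-solve-∀

sgn : Bool → ℚ
sgn true  = 1ℚ
sgn false = - 1ℚ

threshold : ℕ → ℕ → ℚ
threshold m j = sgn (does (j ℕ.≤? m))

threshold-≤ : ∀ {m j} → j ℕ.≤ m → threshold m j ≡ 1ℚ
threshold-≤ {m} {j} j≤m = cong sgn (dec-true (j ℕ.≤? m) j≤m)

threshold-> : ∀ {m j} → m ℕ.< j → threshold m j ≡ - 1ℚ
threshold-> {m} {j} m<j = cong sgn (dec-false (j ℕ.≤? m) (ℕ.<⇒≱ m<j))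

δ-refl : ∀ m → δ m m ≡ 1ℚ
δ-refl m = cong (λ b → if b then 1ℚ else 0ℚ) (dec-true (m ℕ.≟ m) refl)

δ-≢ : ∀ {m j} → j ≢ m → δ m j ≡ 0ℚ
δ-≢ {m} {j} j≢m = cong (λ b → if b then 1ℚ else 0ℚ) (dec-false (j ℕ.≟ m) j≢m)

∣Δ⁻threshold∣ : ∀ m j → ∣ threshold m j - threshold m (suc j) ∣ ≡ two * δ m j
∣Δ⁻threshold∣ m j with ℕ.<-cmp j m
... | tri< j<m _ _ rewrite threshold-≤ (ℕ.<⇒≤ j<m) | threshold-≤ j<m | δ-≢ (ℕ.<⇒≢ j<m) = refl
... | tri≈ _ refl _ rewrite threshold-≤ (ℕ.≤-refl {j}) | threshold-> (ℕ.n<1+n j) | δ-refl j = refl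
... | tri> _ _ m<j rewrite threshold-> m<j | threshold-> (ℕ.m<n⇒m<1+n m<j) | δ-≢ (ℕ.>⇒≢ m<j) = refl

2*j≤n⇔j≤m : ∀ {m n j} → 2 ℕ.* m ℕ.≤ n → n ℕ.≤ suc (2 ℕ.* m) → (2 ℕ.* j ℕ.≤ n ⇔ j ℕ.≤ m)
2*j≤n⇔j≤m {m} {n} {j} 2m≤n n≤1+2m = mk⇔ to from
  where
  to : 2 ℕ.* j ℕ.≤ n → j ℕ.≤ m
  to 2j≤n = ℕ.≤-pred (ℕ.*-cancelˡ-< 2 j (suc m)
    (ℕ.≤-<-trans (ℕ.≤-trans 2j≤n n≤1+2m) (subst (suc (2 ℕ.* m) ℕ.<_) (sym (ℕ.*-suc 2 m)) (ℕ.n<1+n _))))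
  from : j ℕ.≤ m → 2 ℕ.* j ℕ.≤ n
  from j≤m = ℕ.≤-trans (ℕ.*-monoʳ-≤ 2 j≤m) 2m≤n

M≡threshold : ∀ {n m} → 2 ℕ.* m ℕ.≤ n → n ℕ.≤ suc (2 ℕ.* m) →
              ∀ x y → M n x y ≡ hammingKernel (threshold m) x y
M≡threshold {n} {m} 2m≤n n≤1+2m x y =
  trans M≡sgn (cong sgn (does-⇔ (2*j≤n⇔j≤m 2m≤n n≤1+2m) (2 ℕ.* hamming x y ℕ.≤? n)
                                                       (hamming x y ℕ.≤? m)))
  where
  M≡sgn : M n x y ≡ sgn (does (2 ℕ.* hamming x y ℕ.≤? n))
  M≡sgn with does (2 ℕ.* hamming x y ℕ.≤? n)
  ... | true  = refl
  ... | false = refl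

threshold-reflect-odd : ∀ m i j → i ℕ.+ j ≡ suc m ℕ.+ m → threshold m i ≡ - threshold m j
threshold-reflect-odd m i j i+j≡ with j ℕ.≤? m
... | yes j≤m rewrite threshold-> (i+j≡m+n∧i<m⇒n<j (trans (ℕ.+-comm j i) i+j≡) (s≤s j≤m))
                    | threshold-≤ j≤m = refl
... | no  j≰m rewrite threshold-≤ (ℕ.≤-pred (i+j≡m+n∧n<j⇒i<m i+j≡ (ℕ.≰⇒> j≰m)))
                    | threshold-> (ℕ.≰⇒> j≰m) = refl

threshold-reflect-even : ∀ m i j → i ℕ.+ j ≡ m ℕ.+ m → threshold m i ≡ two * δ m j - threshold m j
threshold-reflect-even m i j i+j≡ with ℕ.<-cmp j m
... | tri< j<m _ _ rewrite threshold-> (i+j≡m+n∧i<m⇒n<j (trans (ℕ.+-comm j i) i+j≡) j<m)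
                         | threshold-≤ (ℕ.<⇒≤ j<m) | δ-≢ (ℕ.<⇒≢ j<m) = refl
... | tri≈ _ refl _ rewrite ℕ.+-cancelʳ-≡ j i j i+j≡ | threshold-≤ (ℕ.≤-refl {j}) | δ-refl j = refl
... | tri> _ _ m<j rewrite threshold-≤ (ℕ.<⇒≤ (i+j≡m+n∧n<j⇒i<m i+j≡ m<j)) | threshold-> m<j
                         | δ-≢ (ℕ.>⇒≢ m<j) = refl

binomialSum-threshold-odd : ∀ m → binomialSum (suc (2 ℕ.* m)) (threshold m) ≡ 0ℚ
binomialSum-threshold-odd m = x≡2y-x⇒x≡y (begin
    binomialSum N (threshold m)
      ≡⟨ binomialSum-reflect N (λ i j i+j≡N → threshold-reflect-odd m i j (trans i+j≡N N≡1+m+m)) ⟩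
    binomialSum N (λ j → - threshold m j)       ≡⟨ binomialSum-neg N (threshold m) ⟩
    - binomialSum N (threshold m)               ≡⟨ ℚ.+-identityˡ _ ⟨
    two * 0ℚ - binomialSum N (threshold m)      ∎)
  where
  open ≡-Reasoning
  N : ℕ
  N = suc (2 ℕ.* m)
  N≡1+m+m : N ≡ suc m ℕ.+ m
  N≡1+m+m = cong suc (2*m≡m+m m)

binomialSum-threshold-even : ∀ m → binomialSum (2 ℕ.* m) (threshold m) ≡ fromℕ ((2 ℕ.* m) C m)
binomialSum-threshold-even m = x≡2y-x⇒x≡y (begin
    binomialSum N (threshold m)
  ≡⟨ binomialSum-reflect N (λ i j i+j≡N → threshold-reflect-even m i j (trans i+j≡N N≡m+m)) ⟩
    binomialSum N (λ j → two * δ m j - threshold m j)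
  ≡⟨ binomialSum-- N (λ j → two * δ m j) (threshold m) ⟩
    binomialSum N (λ j → two * δ m j) - binomialSum N (threshold m)
  ≡⟨ cong (_- binomialSum N (threshold m)) (binomialSum-* N two (δ m)) ⟩
    two * binomialSum N (δ m) - binomialSum N (threshold m)
  ≡⟨ cong (λ s → two * s - binomialSum N (threshold m)) (binomialSum-δ N m) ⟩
    two * fromℕ (N C m) - binomialSum N (threshold m)
  ∎)
  where
  open ≡-Reasoning
  N : ℕ
  N = 2 ℕ.* m
  N≡m+m : N ≡ m ℕ.+ m
  N≡m+m = 2*m≡m+m m

σ₁²≤-threshold : ∀ a m {b} →
                 binomialSum (suc a) (threshold m) * binomialSum (suc a) (threshold m) ≤ b →
                 fromℕ (2 ℕ.* (a C m)) * fromℕ (2 ℕ.* (a C m)) ≤ b →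
                 σ₁²≤ (hammingKernel {suc a} (threshold m)) b
σ₁²≤-threshold a m {b} top≤b jumps≤b = hammingKernel-σ₁²≤ (suc a) (threshold m)
  (eigenvalues-bounded a {threshold m} {λ j → two * δ m j} (λ j → ℚ.≤-reflexive (∣Δ⁻threshold∣ m j)) top≤b
    (subst (λ r → r * r ≤ b) (sym jumpSum) jumps≤b))
  where
  jumpSum : binomialSum a (λ j → two * δ m j) ≡ fromℕ (2 ℕ.* (a C m))
  jumpSum = trans (binomialSum-* a two (δ m))
                  (trans (cong (two *_) (binomialSum-δ a m)) (sym (fromℕ-* 2 (a C m))))

σ₁²≤-M-odd : ∀ k → σ₁²≤ (M (suc (2 ℕ.* k))) (+ (4 ^ suc (2 ℕ.* k)) / suc (2 ℕ.* k))
σ₁²≤-M-odd k = σ₁²≤-cong {b = bound} (λ x y → sym (M≡threshold (ℕ.n≤1+n (2 ℕ.* k)) ℕ.≤-refl x y))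
  (σ₁²≤-threshold (2 ℕ.* k) k top≤ (fromℕ²≤4^n/n {2 ℕ.* c} (2 ℕ.* k) jumps≤))
  where
  N c : ℕ
  N = suc (2 ℕ.* k)
  c = (2 ℕ.* k) C k
  bound : ℚ
  bound = + (4 ^ N) / N
  top≤ : binomialSum N (threshold k) * binomialSum N (threshold k) ≤ bound
  top≤ = subst (λ t → t * t ≤ bound) (sym (binomialSum-threshold-odd k)) (fromℕ²≤4^n/n {0} (2 ℕ.* k) z≤n)
  jumps≤ : 2 ℕ.* c ℕ.* (2 ℕ.* c) ℕ.* N ℕ.≤ 4 ^ N
  jumps≤ = ℕ.≤-trans (ℕ.≤-reflexive (regroup c N)) (ℕ.*-monoʳ-≤ 4 (centralBinomial-bound k))
    where
    regroup : ∀ c n → 2 ℕ.* c ℕ.* (2 ℕ.* c) ℕ.* n ≡ 4 ℕ.* (c ℕ.* c ℕ.* n)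
    regroup = ℕ-solve-∀

σ₁²≤-M-even : ∀ k → σ₁²≤ (M (suc (suc (2 ℕ.* k)))) (+ (4 ^ suc (suc (2 ℕ.* k))) / suc (suc (2 ℕ.* k)))
σ₁²≤-M-even k = σ₁²≤-cong {b = bound} (λ x y → sym (M≡threshold 2[1+k]≤N N≤1+2[1+k] x y))
  (σ₁²≤-threshold (suc (2 ℕ.* k)) (suc k) top≤ jumps≤)
  where
  N D : ℕ
  N = suc (suc (2 ℕ.* k))
  D = N C suc k
  bound : ℚ
  bound = + (4 ^ N) / N
  2[1+k]≡N : 2 ℕ.* suc k ≡ N
  2[1+k]≡N = ℕ.*-suc 2 k
  2[1+k]≤N : 2 ℕ.* suc k ℕ.≤ N
  2[1+k]≤N = ℕ.≤-reflexive 2[1+k]≡N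
  N≤1+2[1+k] : N ℕ.≤ suc (2 ℕ.* suc k)
  N≤1+2[1+k] = ℕ.m≤n⇒m≤1+n (ℕ.≤-reflexive (sym 2[1+k]≡N))
  D²N≤4^N : D ℕ.* D ℕ.* N ℕ.≤ 4 ^ N
  D²N≤4^N = ℕ.≤-trans (ℕ.*-monoʳ-≤ (D ℕ.* D) (ℕ.n≤1+n N))
    (subst (λ n → (n C suc k) ℕ.* (n C suc k) ℕ.* suc n ℕ.≤ 4 ^ n) 2[1+k]≡N (centralBinomial-bound (suc k)))
  top≡D : binomialSum N (threshold (suc k)) ≡ fromℕ D
  top≡D = subst (λ n → binomialSum n (threshold (suc k)) ≡ fromℕ (n C suc k)) 2[1+k]≡N
                (binomialSum-threshold-even (suc k))
  top≤ : binomialSum N (threshold (suc k)) * binomialSum N (threshold (suc k)) ≤ bound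
  top≤ = subst (λ t → t * t ≤ bound) (sym top≡D) (fromℕ²≤4^n/n {D} (suc (2 ℕ.* k)) D²N≤4^N)
  jumps≤ : fromℕ (2 ℕ.* (suc (2 ℕ.* k) C suc k)) * fromℕ (2 ℕ.* (suc (2 ℕ.* k) C suc k)) ≤ bound
  jumps≤ = subst (λ t → fromℕ t * fromℕ t ≤ bound) ([2k+2]C[k+1]≡2*[2k+1]C[k+1] k)
                 (fromℕ²≤4^n/n {D} (suc (2 ℕ.* k)) D²N≤4^N)

data EvenOdd : ℕ → Set where
  even : ∀ k → EvenOdd (2 ℕ.* k)
  odd  : ∀ k → EvenOdd (suc (2 ℕ.* k))

evenOdd : ∀ n → EvenOdd n
evenOdd zero = even 0
evenOdd (suc n) with evenOdd n
... | even k = odd k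
... | odd k  = subst EvenOdd (ℕ.*-suc 2 k) (even (suc k))

σ₁²≤-M : ∀ n → σ₁²≤ (M (suc n)) (+ (4 ^ suc n) / suc n)
σ₁²≤-M n with evenOdd n
... | even k = σ₁²≤-M-odd k
... | odd k  = σ₁²≤-M-even k

claim4p4 : ∃ λ (C : ℚ) → (0ℚ < C) × (∀ (n : ℕ) → σ₁²≤ (M (suc n)) ((C * C) * ((+ (4 ^ suc n)) / suc n)))
claim4p4 = 1ℚ , ℚ.positive⁻¹ 1ℚ , λ n →
  subst (σ₁²≤ (M (suc n))) (sym (ℚ.*-identityˡ (+ (4 ^ suc n) / suc n))) (σ₁²≤-M n)
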